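{- The assignment $\mathcal B\mapsto\mathcal R(\mathcal B)$ extends to a functor $\mathcal R\colon\mathbf{CBC}\to\mathbf{EED}$ which sends a morphism of cartesian bicategories $F\colon\mathcal A\to\mathcal B$ to $\mathcal R(F)=(F\restriction_{\mathrm{Map}(\mathcal A)},b^F)$, where $F\restriction_{\mathrm{Map}(\mathcal A)}\colon\mathrm{Map}(\mathcal A)\to\mathrm{Map}(\mathcal B)$ is the restriction of $F$ and $b^F\colon\mathcal R(\mathcal A)\to\mathcal R(\mathcal B)\circ(F\restriction_{\mathrm{Map}(\mathcal A)})^{op}$ has components $b^F_A(U)=F(U)\in\mathrm{Hom}_{\mathcal B}(F(A),I)$ for all $A\in\mathcal A$ and $U\in\mathrm{Hom}_{\mathcal A}(A,I)$.
   Context: Composition is written diagrammatically as $f;g$. A cartesian bicategory is a symmetric monoidal category $(\mathcal B,\otimes,I)$ enriched in posets (hom-sets are posets; composition and $\otimes$ monotone), in which every object $X$ is equipped with $d_X\colon X\to X\otimes X$, $e_X\colon X\to I$ such that: (1) $(d_X,e_X)$ is a cocommutative comonoid; (2) $d_X,e_X$ have right adjoints $d_X^*,e_X^*$ ($\mathrm{id}\le d_X;d_X^*$, $d_X^*;d_X\le\mathrm{id}$, $\mathrm{id}\le e_X;e_X^*$, $e_X^*;e_X\le\mathrm{id}$); (3) Frobenius law $(d_X\otimes\mathrm{id}_X);(\mathrm{id}_X\otimes d_X^*)=d_X^*;d_X$; (4) every $R\colon X\to Y$ satisfies $R;d_Y\le d_X;(R\otimes R)$ and $R;e_Y\le e_X$;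 (5) coherence: $e_{X\otimes Y}=e_X\otimes e_Y$, $d_{X\otimes Y}=(d_X\otimes d_Y);(\mathrm{id}\otimes\sigma_{X,Y}\otimes\mathrm{id})$ up to coherence isomorphisms. A map is an $f$ with $f;d_Y=d_X;(f\otimes f)$, $f;e_Y=e_X$; maps form a cartesian subcategory $\mathrm{Map}(\mathcal B)$ with product $\otimes$ and terminal object $I$. A morphism of cartesian bicategories is a strict monoidal functor preserving the order and the chosen $d_X,e_X,d_X^*,e_X^*$; these form the category $\mathbf{CBC}$; such a functor restricts to a strict cartesian functor between the categories of maps. Each $\mathrm{Hom}_{\mathcal B}(X,I)$ is a meet-semilattice with top $e_X$ and meet $R\wedge S=d_X;(R\otimes S)$, and $\mathcal R(\mathcal B)=\mathrm{Hom}_{\mathcal B}(-,I)\colon\mathrm{Map}(\mathcal B)^{op}\to\mathbf{InfSL}$ sends $f\colon X\to Y$ to $U\mapsto f;U$; it is an elementary existential doctrine. $\mathbf{InfSL}$: meet-semilattices with top and finite-meet-preserving maps. Elementary existential doctrines: for a cartesian category $\mathcal C$ (chosen products $\times$, projections $\pi_i$, terminal $I$, diagonals $\Delta_A$), a functor $P\colon\mathcal C^{op}\to\mathbf{InfSL}$ (write $P_f=P(f)$) is one if there are $\delta_A\in P(A\times A)$ such that for $e=\mathrm{id}_X\times\Delta_A$, $P_e$ has left adjoint $\exists_e(\alpha)=P_{\langle\pi_1,\pi_2\rangle}(\alpha)\wedge P_{\langle\pi_2,\pi_3\rangle}(\delta_A)$, and each $P_{\pi}$ for a product projection $\pi$ has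 a left adjoint $\exists_\pi$ satisfying Beck–Chevalley along pullbacks of projections and Frobenius reciprocity $\exists_\pi(P_\pi(\alpha)\wedge\beta)=\alpha\wedge\exists_\pi(\beta)$. The category $\mathbf{EED}$ has elementary existential doctrines as objects; a morphism from $P\colon\mathcal C^{op}\to\mathbf{InfSL}$ to $R\colon\mathcal D^{op}\to\mathbf{InfSL}$ is a pair $(F,b)$ with $F\colon\mathcal C\to\mathcal D$ a strict cartesian functor (preserving chosen products, projections and terminal object on the nose) and $b\colon P\to R\circ F^{op}$ a natural transformation with $b_{A\times A}(\delta^P_A)=\delta^R_{F(A)}$ and $b_A\circ\exists^P_\pi=\exists^R_{F(\pi)}\circ b_{X\times A}$ for every projection $\pi\colon X\times A\to A$; composition is $(G,c)\circ(F,b)=(GF,cF\circ b)$. -}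

module Defs where

open import Level using (Level; _⊔_) renaming (suc to lsuc)
open import Data.Product using (Σ; _×_; _,_; Σ-syntax)
open import Relation.Binary.PropositionalEquality using (_≡_; refl; trans; cong)

-- Poset-enriched symmetric monoidal categories (non-strict, with
-- explicit coherence isomorphisms).  Composition is diagrammatic: f ⨾ g.

record SymMonPoset (o ℓ r : Level) : Set (lsuc (o ⊔ ℓ ⊔ r)) where
  infixr 9 _⨾_
  infixr 10 _⊗₀_ _⊗₁_
  infix 4 _≤_
  field
    Obj : Set o
    -- objects form a set (h-set), as in the paper's set-based mathematics
    Obj-isSet : ∀ {X Y : Obj} (p q : X ≡ Y) → p ≡ q
    Hom : Obj → Obj → Set ℓ
    _≤_ : ∀ {X Y} → Hom X Y → Hom X Y → Set r
    ≤-refl : ∀ {X Y} {f : Hom X Y} → f ≤ f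
    ≤-trans : ∀ {X Y} {f g h : Hom X Y} → f ≤ g → g ≤ h → f ≤ h
    ≤-antisym : ∀ {X Y} {f g : Hom X Y} → f ≤ g → g ≤ f → f ≡ g
    id : ∀ {X} → Hom X X
    _⨾_ : ∀ {X Y Z} → Hom X Y → Hom Y Z → Hom X Z
    ⨾-assoc : ∀ {W X Y Z} (f : Hom W X) (g : Hom X Y) (h : Hom Y Z) →
              (f ⨾ g) ⨾ h ≡ f ⨾ (g ⨾ h)
    ⨾-idˡ : ∀ {X Y} (f : Hom X Y) → id ⨾ f ≡ f
    ⨾-idʳ : ∀ {X Y} (f : Hom X Y) → f ⨾ id ≡ f
    ⨾-mono : ∀ {X Y Z} {f f' : Hom X Y} {g g' : Hom Y Z} →
             f ≤ f' → g ≤ g' → f ⨾ g ≤ f' ⨾ g'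
    I : Obj
    _⊗₀_ : Obj → Obj → Obj
    _⊗₁_ : ∀ {X Y X' Y'} → Hom X Y → Hom X' Y' → Hom (X ⊗₀ X') (Y ⊗₀ Y')
    ⊗-id : ∀ {X Y} → id {X} ⊗₁ id {Y} ≡ id
    ⊗-⨾ : ∀ {X Y Z X' Y' Z'} (f : Hom X Y) (g : Hom Y Z) (h : Hom X' Y') (k : Hom Y' Z') →
          (f ⨾ g) ⊗₁ (h ⨾ k) ≡ (f ⊗₁ h) ⨾ (g ⊗₁ k)
    ⊗-mono : ∀ {X Y X' Y'} {f f' : Hom X Y} {g g' : Hom X' Y'} →
             f ≤ f' → g ≤ g' → f ⊗₁ g ≤ f' ⊗₁ g'
    assoc : ∀ X Y Z → Hom ((X ⊗₀ Y) ⊗₀ Z) (X ⊗₀ (Y ⊗₀ Z))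
    assoc⁻¹ : ∀ X Y Z → Hom (X ⊗₀ (Y ⊗₀ Z)) ((X ⊗₀ Y) ⊗₀ Z)
    assoc-iso₁ : ∀ X Y Z → assoc X Y Z ⨾ assoc⁻¹ X Y Z ≡ id
    assoc-iso₂ : ∀ X Y Z → assoc⁻¹ X Y Z ⨾ assoc X Y Z ≡ id
    assoc-nat : ∀ {X Y Z X' Y' Z'} (f : Hom X X') (g : Hom Y Y') (h : Hom Z Z') →
                ((f ⊗₁ g) ⊗₁ h) ⨾ assoc X' Y' Z' ≡ assoc X Y Z ⨾ (f ⊗₁ (g ⊗₁ h))
    lunit : ∀ X → Hom (I ⊗₀ X) X
    lunit⁻¹ : ∀ X → Hom X (I ⊗₀ X)
    lunit-iso₁ : ∀ X → lunit X ⨾ lunit⁻¹ X ≡ id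
    lunit-iso₂ : ∀ X → lunit⁻¹ X ⨾ lunit X ≡ id
    lunit-nat : ∀ {X Y} (f : Hom X Y) → (id {I} ⊗₁ f) ⨾ lunit Y ≡ lunit X ⨾ f
    runit : ∀ X → Hom (X ⊗₀ I) X
    runit⁻¹ : ∀ X → Hom X (X ⊗₀ I)
    runit-iso₁ : ∀ X → runit X ⨾ runit⁻¹ X ≡ id
    runit-iso₂ : ∀ X → runit⁻¹ X ⨾ runit X ≡ id
    runit-nat : ∀ {X Y} (f : Hom X Y) → (f ⊗₁ id {I}) ⨾ runit Y ≡ runit X ⨾ f
    swap : ∀ X Y → Hom (X ⊗₀ Y) (Y ⊗₀ X)
    swap-inv : ∀ X Y → swap X Y ⨾ swap Y X ≡ id
    swap-nat : ∀ {X Y X' Y'} (f : Hom X X') (g : Hom Y Y') →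
               (f ⊗₁ g) ⨾ swap X' Y' ≡ swap X Y ⨾ (g ⊗₁ f)
    pentagon : ∀ W X Y Z →
      (assoc W X Y ⊗₁ id {Z}) ⨾ assoc W (X ⊗₀ Y) Z ⨾ (id {W} ⊗₁ assoc X Y Z)
        ≡ assoc (W ⊗₀ X) Y Z ⨾ assoc W X (Y ⊗₀ Z)
    triangle : ∀ X Y → assoc X I Y ⨾ (id {X} ⊗₁ lunit Y) ≡ runit X ⊗₁ id {Y}
    hexagon : ∀ X Y Z →
      assoc X Y Z ⨾ swap X (Y ⊗₀ Z) ⨾ assoc Y Z X
        ≡ (swap X Y ⊗₁ id {Z}) ⨾ assoc Y X Z ⨾ (id {Y} ⊗₁ swap X Z)

module SMPNotation {o ℓ r} (M : SymMonPoset o ℓ r) where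
  open SymMonPoset M

  -- middle-four interchange (X⊗X')⊗(Y⊗Y') → (X⊗Y)⊗(X'⊗Y'),
  -- i.e. id ⊗ σ ⊗ id up to the coherence isomorphisms
  interchange : ∀ X X' Y Y' → Hom ((X ⊗₀ X') ⊗₀ (Y ⊗₀ Y')) ((X ⊗₀ Y) ⊗₀ (X' ⊗₀ Y'))
  interchange X X' Y Y' =
    assoc X X' (Y ⊗₀ Y')
    ⨾ (id {X} ⊗₁ assoc⁻¹ X' Y Y')
    ⨾ (id {X} ⊗₁ (swap X' Y ⊗₁ id {Y'}))
    ⨾ (id {X} ⊗₁ assoc Y X' Y')
    ⨾ assoc⁻¹ X Y (X' ⊗₀ Y')

record CartesianBicategory (o ℓ r : Level) : Set (lsuc (o ⊔ ℓ ⊔ r)) where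
  field
    smp : SymMonPoset o ℓ r
  open SymMonPoset smp public
  open SMPNotation smp public
  field
    d  : ∀ X → Hom X (X ⊗₀ X)
    e  : ∀ X → Hom X I
    d* : ∀ X → Hom (X ⊗₀ X) X
    e* : ∀ X → Hom I X
    d-coassoc : ∀ X → d X ⨾ (d X ⊗₁ id {X}) ⨾ assoc X X X ≡ d X ⨾ (id {X} ⊗₁ d X)
    d-counitˡ : ∀ X → d X ⨾ (e X ⊗₁ id {X}) ⨾ lunit X ≡ id
    d-counitʳ : ∀ X → d X ⨾ (id {X} ⊗₁ e X) ⨾ runit X ≡ id
    d-cocomm  : ∀ X → d X ⨾ swap X X ≡ d X
    d-unit   : ∀ X → id ≤ d X ⨾ d* X
    d-counit : ∀ X → d* X ⨾ d X ≤ id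
    e-unit   : ∀ X → id ≤ e X ⨾ e* X
    e-counit : ∀ X → e* X ⨾ e X ≤ id
    frobenius : ∀ X → (d X ⊗₁ id {X}) ⨾ assoc X X X ⨾ (id {X} ⊗₁ d* X) ≡ d* X ⨾ d X
    d-lax : ∀ {X Y} (R : Hom X Y) → R ⨾ d Y ≤ d X ⨾ (R ⊗₁ R)
    e-lax : ∀ {X Y} (R : Hom X Y) → R ⨾ e Y ≤ e X
    e-⊗ : ∀ X Y → e (X ⊗₀ Y) ≡ (e X ⊗₁ e Y) ⨾ lunit I
    d-⊗ : ∀ X Y → d (X ⊗₀ Y) ≡ (d X ⊗₁ d Y) ⨾ interchange X X Y Y

module CBNotation {o ℓ r} (B : CartesianBicategory o ℓ r) where
  open CartesianBicategory B

  IsMap : ∀ {X Y} → Hom X Y → Set ℓ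
  IsMap {X} {Y} f = (f ⨾ d Y ≡ d X ⨾ (f ⊗₁ f)) × (f ⨾ e Y ≡ e X)

  Arr : Set (o ⊔ ℓ)
  Arr = Σ[ X ∈ Obj ] Σ[ Y ∈ Obj ] Hom X Y

  ⌈_⌉ : ∀ {X Y} → Hom X Y → Arr
  ⌈_⌉ {X} {Y} f = X , Y , f

  cast : ∀ {X X' Y Y'} → X ≡ X' → Y ≡ Y' → Hom X Y → Hom X' Y'
  cast refl refl f = f

  castDom : ∀ {X X' Y} → X ≡ X' → Hom X Y → Hom X' Y
  castDom p = cast p refl

  castCod : ∀ {X Y Y'} → Y ≡ Y' → Hom X Y → Hom X Y'
  castCod q = cast refl q

  -- chosen cartesian structure of Map(B): product ⊗, terminal I
  π₁ : ∀ X Y → Hom (X ⊗₀ Y) X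
  π₁ X Y = (id {X} ⊗₁ e Y) ⨾ runit X

  π₂ : ∀ X Y → Hom (X ⊗₀ Y) Y
  π₂ X Y = (e X ⊗₁ id {Y}) ⨾ lunit Y

  -- the doctrine R(B) = Hom(-, I) : fibres, top, meet, reindexing
  Pred : Obj → Set ℓ
  Pred X = Hom X I

  ⊤ₚ : ∀ X → Pred X
  ⊤ₚ X = e X

  _∧ₚ_ : ∀ {X} → Pred X → Pred X → Pred X
  _∧ₚ_ {X} U V = d X ⨾ (U ⊗₁ V) ⨾ lunit I

  δ : ∀ A → Pred (A ⊗₀ A)
  δ A = d* A ⨾ e A

  -- ∃ along the projection π₂ : X ⊗ A → A  (left adjoint of π₂ ⨾ -)
  ∃π₂ : ∀ X A → Pred (X ⊗₀ A) → Pred A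
  ∃π₂ X A V = lunit⁻¹ A ⨾ (e* X ⊗₁ id {A}) ⨾ V

-- Preservation of arrows whose type changes
-- along F₀(X⊗Y) = F₀X ⊗ F₀Y is stated as equality in Arr.

record CBCMorphism {o ℓ r} (A B : CartesianBicategory o ℓ r) : Set (o ⊔ ℓ ⊔ r) where
  private
    module A = CartesianBicategory A
    module B = CartesianBicategory B
  open CBNotation B using (⌈_⌉)
  field
    F₀ : A.Obj → B.Obj
    F₁ : ∀ {X Y} → A.Hom X Y → B.Hom (F₀ X) (F₀ Y)
    F-id : ∀ {X} → F₁ (A.id {X}) ≡ B.id
    F-⨾ : ∀ {X Y Z} (f : A.Hom X Y) (g : A.Hom Y Z) → F₁ (f A.⨾ g) ≡ F₁ f B.⨾ F₁ g
    F-mono : ∀ {X Y} {f g : A.Hom X Y} → f A.≤ g → F₁ f B.≤ F₁ g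
    F-I : F₀ A.I ≡ B.I
    F-⊗₀ : ∀ X Y → F₀ (X A.⊗₀ Y) ≡ F₀ X B.⊗₀ F₀ Y
    F-⊗₁ : ∀ {X Y X' Y'} (f : A.Hom X Y) (g : A.Hom X' Y') →
           ⌈ F₁ (f A.⊗₁ g) ⌉ ≡ ⌈ F₁ f B.⊗₁ F₁ g ⌉
    F-assoc : ∀ X Y Z → ⌈ F₁ (A.assoc X Y Z) ⌉ ≡ ⌈ B.assoc (F₀ X) (F₀ Y) (F₀ Z) ⌉
    F-lunit : ∀ X → ⌈ F₁ (A.lunit X) ⌉ ≡ ⌈ B.lunit (F₀ X) ⌉
    F-runit : ∀ X → ⌈ F₁ (A.runit X) ⌉ ≡ ⌈ B.runit (F₀ X) ⌉
    F-d  : ∀ X → ⌈ F₁ (A.d X) ⌉ ≡ ⌈ B.d (F₀ X) ⌉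
    F-e  : ∀ X → ⌈ F₁ (A.e X) ⌉ ≡ ⌈ B.e (F₀ X) ⌉
    F-d* : ∀ X → ⌈ F₁ (A.d* X) ⌉ ≡ ⌈ B.d* (F₀ X) ⌉
    F-e* : ∀ X → ⌈ F₁ (A.e* X) ⌉ ≡ ⌈ B.e* (F₀ X) ⌉

module _ {o ℓ r} {A B : CartesianBicategory o ℓ r} where
  arrMap : CBCMorphism A B → CBNotation.Arr A → CBNotation.Arr B
  arrMap F (X , Y , f) = F₀ X , F₀ Y , F₁ f
    where open CBCMorphism F

idCBC : ∀ {o ℓ r} (A : CartesianBicategory o ℓ r) → CBCMorphism A A
idCBC A = record
  { F₀ = λ X → X ; F₁ = λ f → f
  ; F-id = refl ; F-⨾ = λ _ _ → refl ; F-mono = λ p → p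
  ; F-I = refl ; F-⊗₀ = λ _ _ → refl ; F-⊗₁ = λ _ _ → refl
  ; F-assoc = λ _ _ _ → refl ; F-lunit = λ _ → refl ; F-runit = λ _ → refl
  ; F-d = λ _ → refl ; F-e = λ _ → refl ; F-d* = λ _ → refl ; F-e* = λ _ → refl }

_∘CBC_ : ∀ {o ℓ r} {A B C : CartesianBicategory o ℓ r} →
         CBCMorphism B C → CBCMorphism A B → CBCMorphism A C
_∘CBC_ {A = A} {B} {C} G F = record
  { F₀ = λ X → G.F₀ (F.F₀ X)
  ; F₁ = λ f → G.F₁ (F.F₁ f)
  ; F-id = trans (cong G.F₁ F.F-id) G.F-id
  ; F-⨾ = λ f g → trans (cong G.F₁ (F.F-⨾ f g)) (G.F-⨾ (F.F₁ f) (F.F₁ g))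
  ; F-mono = λ p → G.F-mono (F.F-mono p)
  ; F-I = trans (cong G.F₀ F.F-I) G.F-I
  ; F-⊗₀ = λ X Y → trans (cong G.F₀ (F.F-⊗₀ X Y)) (G.F-⊗₀ (F.F₀ X) (F.F₀ Y))
  ; F-⊗₁ = λ f g → trans (cong (arrMap G) (F.F-⊗₁ f g)) (G.F-⊗₁ (F.F₁ f) (F.F₁ g))
  ; F-assoc = λ X Y Z → trans (cong (arrMap G) (F.F-assoc X Y Z)) (G.F-assoc _ _ _)
  ; F-lunit = λ X → trans (cong (arrMap G) (F.F-lunit X)) (G.F-lunit _)
  ; F-runit = λ X → trans (cong (arrMap G) (F.F-runit X)) (G.F-runit _)
  ; F-d = λ X → trans (cong (arrMap G) (F.F-d X)) (G.F-d _)
  ; F-e = λ X → trans (cong (arrMap G) (F.F-e X)) (G.F-e _)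
  ; F-d* = λ X → trans (cong (arrMap G) (F.F-d* X)) (G.F-d* _)
  ; F-e* = λ X → trans (cong (arrMap G) (F.F-e* X)) (G.F-e* _) }
  where
    module F = CBCMorphism F
    module G = CBCMorphism G

-- Morphisms between the doctrines R(A) and R(B) (as data): a functor
-- part on Map(A) (given by its action on objects and arrows) and the
-- components b_X : R(A)(X) → R(B)(F X).

record DocMorphism {o ℓ r} (A B : CartesianBicategory o ℓ r) : Set (o ⊔ ℓ) where
  private
    module A = CartesianBicategory A
    module B = CartesianBicategory B
  field
    fun₀ : A.Obj → B.Obj
    fun₁ : ∀ {X Y} → A.Hom X Y → B.Hom (fun₀ X) (fun₀ Y)
    comp : ∀ X → A.Hom X A.I → B.Hom (fun₀ X) B.I

record IsEEDMorphism {o ℓ r} (A B : CartesianBicategory o ℓ r)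
                     (m : DocMorphism A B) : Set (o ⊔ ℓ) where
  private
    module A = CartesianBicategory A
    module B = CartesianBicategory B
    module An = CBNotation A
    module Bn = CBNotation B
  open DocMorphism m
  field
    map-preserved : ∀ {X Y} (f : A.Hom X Y) → An.IsMap f → Bn.IsMap (fun₁ f)
    fun-id : ∀ {X} → fun₁ (A.id {X}) ≡ B.id
    fun-⨾ : ∀ {X Y Z} (f : A.Hom X Y) (g : A.Hom Y Z) → An.IsMap f → An.IsMap g →
            fun₁ (f A.⨾ g) ≡ fun₁ f B.⨾ fun₁ g
    fun-× : ∀ X Y → fun₀ (X A.⊗₀ Y) ≡ fun₀ X B.⊗₀ fun₀ Y
    fun-⊤ : fun₀ A.I ≡ B.I
    fun-π₁ : ∀ X Y → Bn.castDom (fun-× X Y) (fun₁ (An.π₁ X Y)) ≡ Bn.π₁ (fun₀ X) (fun₀ Y)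
    fun-π₂ : ∀ X Y → Bn.castDom (fun-× X Y) (fun₁ (An.π₂ X Y)) ≡ Bn.π₂ (fun₀ X) (fun₀ Y)
    comp-natural : ∀ {X Y} (f : A.Hom X Y) → An.IsMap f → (U : A.Hom Y A.I) →
                   comp X (f A.⨾ U) ≡ fun₁ f B.⨾ comp Y U
    comp-⊤ : ∀ X → comp X (An.⊤ₚ X) ≡ Bn.⊤ₚ (fun₀ X)
    comp-∧ : ∀ X (U V : A.Hom X A.I) → comp X (U An.∧ₚ V) ≡ (comp X U Bn.∧ₚ comp X V)
    comp-δ : ∀ X → Bn.castDom (fun-× X X) (comp (X A.⊗₀ X) (An.δ X)) ≡ Bn.δ (fun₀ X)
    comp-∃ : ∀ X Y (V : A.Hom (X A.⊗₀ Y) A.I) →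
             comp Y (An.∃π₂ X Y V)
               ≡ Bn.∃π₂ (fun₀ X) (fun₀ Y) (Bn.castDom (fun-× X Y) (comp (X A.⊗₀ Y) V))

idEED : ∀ {o ℓ r} (A : CartesianBicategory o ℓ r) → DocMorphism A A
idEED A = record { fun₀ = λ X → X ; fun₁ = λ f → f ; comp = λ X U → U }

_∘EED_ : ∀ {o ℓ r} {A B C : CartesianBicategory o ℓ r} →
         DocMorphism B C → DocMorphism A B → DocMorphism A C
G ∘EED F = record
  { fun₀ = λ X → G.fun₀ (F.fun₀ X)
  ; fun₁ = λ f → G.fun₁ (F.fun₁ f)
  ; comp = λ X U → G.comp (F.fun₀ X) (F.comp X U) }
  where
    module F = DocMorphism F
    module G = DocMorphism G

_≈EED_ : ∀ {o ℓ r} {A B : CartesianBicategory o ℓ r} →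
         DocMorphism A B → DocMorphism A B → Set (o ⊔ ℓ)
_≈EED_ {A = A} {B} m m' =
  Σ[ p ∈ (∀ X → M.fun₀ X ≡ M'.fun₀ X) ]
    ((∀ {X Y} (f : A.Hom X Y) → An.IsMap f → Bn.cast (p X) (p Y) (M.fun₁ f) ≡ M'.fun₁ f)
     × (∀ X (U : A.Hom X A.I) → Bn.castDom (p X) (M.comp X U) ≡ M'.comp X U))
  where
    module A = CartesianBicategory A
    module An = CBNotation A
    module Bn = CBNotation B
    module M = DocMorphism m
    module M' = DocMorphism m'

R₁ : ∀ {o ℓ r} {A B : CartesianBicategory o ℓ r} → CBCMorphism A B → DocMorphism A B
R₁ {B = B} F = record
  { fun₀ = F₀
  ; fun₁ = F₁
  ; comp = λ X U → CBNotation.castCod B F-I (F₁ U) }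
  where open CBCMorphism F

{-# OPTIONS --safe #-}
-- A morphism of cartesian bicategories preserves, on the nose, every arrow
-- out of which the structure of R(B) is built (d, e, d*, e*, unitors, ⊗, ⨾),
-- so it preserves maps, projections, top, meets, δ and ∃π₂; only the
-- identifications F(X ⊗ Y) = F X ⊗ F Y and F I = I have to be tracked, which
-- is done by comparing arrows together with their (co)domains.
module Submission where

open import Defs
open import Data.Product using (_×_; _,_)
open import Relation.Binary.PropositionalEquality
  using (_≡_; refl; sym; trans; cong; module ≡-Reasoning)

module ArrowEquality {o ℓ r} (B : CartesianBicategory o ℓ r) where
  open CartesianBicategory B
  open CBNotation B

  ⌈⌉-injective : ∀ {X Y} {f g : Hom X Y} → ⌈ f ⌉ ≡ ⌈ g ⌉ → f ≡ g
  ⌈⌉-injective refl = refl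

  ⌈⌉⇒cast≡ : ∀ {X Y X' Y'} {f : Hom X Y} {g : Hom X' Y'} → ⌈ f ⌉ ≡ ⌈ g ⌉ →
             (p : X ≡ X') (q : Y ≡ Y') → cast p q f ≡ g
  ⌈⌉⇒cast≡ refl refl refl = refl

  ⌈cast⌉ : ∀ {X Y X' Y'} (p : X ≡ X') (q : Y ≡ Y') (f : Hom X Y) → ⌈ cast p q f ⌉ ≡ ⌈ f ⌉
  ⌈cast⌉ refl refl f = refl

  ⌈id⌉ : ∀ {X X'} → X ≡ X' → ⌈ id {X} ⌉ ≡ ⌈ id {X'} ⌉
  ⌈id⌉ refl = refl

  ⌈⌉-⨾ : ∀ {X Y Z X' Y' Z'} {f : Hom X Y} {g : Hom Y Z} {f' : Hom X' Y'} {g' : Hom Y' Z'} →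
         ⌈ f ⌉ ≡ ⌈ f' ⌉ → ⌈ g ⌉ ≡ ⌈ g' ⌉ → ⌈ f ⨾ g ⌉ ≡ ⌈ f' ⨾ g' ⌉
  ⌈⌉-⨾ refl refl = refl

  ⌈⌉-⊗ : ∀ {X Y Z W X' Y' Z' W'} {f : Hom X Y} {g : Hom Z W} {f' : Hom X' Y'} {g' : Hom Z' W'} →
         ⌈ f ⌉ ≡ ⌈ f' ⌉ → ⌈ g ⌉ ≡ ⌈ g' ⌉ → ⌈ f ⊗₁ g ⌉ ≡ ⌈ f' ⊗₁ g' ⌉
  ⌈⌉-⊗ refl refl = refl

  ⌈⌉-inverse-unique : ∀ {X Y X' Y'} {f : Hom X Y} {f⁻¹ : Hom Y X} {g : Hom X' Y'} {g⁻¹ : Hom Y' X'} →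
                      f⁻¹ ⨾ f ≡ id → g ⨾ g⁻¹ ≡ id → ⌈ f ⌉ ≡ ⌈ g ⌉ → ⌈ f⁻¹ ⌉ ≡ ⌈ g⁻¹ ⌉
  ⌈⌉-inverse-unique {f = f} {f⁻¹} {g⁻¹ = g⁻¹} left right refl = cong ⌈_⌉ (begin
    f⁻¹                ≡⟨ sym (⨾-idʳ f⁻¹) ⟩
    f⁻¹ ⨾ id           ≡⟨ cong (f⁻¹ ⨾_) (sym right) ⟩
    f⁻¹ ⨾ (f ⨾ g⁻¹)    ≡⟨ sym (⨾-assoc f⁻¹ f g⁻¹) ⟩
    (f⁻¹ ⨾ f) ⨾ g⁻¹    ≡⟨ cong (_⨾ g⁻¹) left ⟩
    id ⨾ g⁻¹           ≡⟨ ⨾-idˡ g⁻¹ ⟩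
    g⁻¹                ∎)
    where open ≡-Reasoning

module MorphismPreservation {o ℓ r} {A B : CartesianBicategory o ℓ r} (F : CBCMorphism A B) where
  private
    module A = CartesianBicategory A
    module An = CBNotation A
  open CartesianBicategory B
  open CBNotation B
  open ArrowEquality B
  open CBCMorphism F

  F-idᵃ : ∀ {X} → ⌈ F₁ (A.id {X}) ⌉ ≡ ⌈ id {F₀ X} ⌉
  F-idᵃ = cong ⌈_⌉ F-id

  F-⨾ᵃ : ∀ {X Y Z X' Y' Z'} {f : A.Hom X Y} {g : A.Hom Y Z} {f' : Hom X' Y'} {g' : Hom Y' Z'} →
         ⌈ F₁ f ⌉ ≡ ⌈ f' ⌉ → ⌈ F₁ g ⌉ ≡ ⌈ g' ⌉ → ⌈ F₁ (f A.⨾ g) ⌉ ≡ ⌈ f' ⨾ g' ⌉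
  F-⨾ᵃ {f = f} {g} Ff Fg = trans (cong ⌈_⌉ (F-⨾ f g)) (⌈⌉-⨾ Ff Fg)

  F-⊗ᵃ : ∀ {X Y Z W X' Y' Z' W'} {f : A.Hom X Y} {g : A.Hom Z W} {f' : Hom X' Y'} {g' : Hom Z' W'} →
         ⌈ F₁ f ⌉ ≡ ⌈ f' ⌉ → ⌈ F₁ g ⌉ ≡ ⌈ g' ⌉ → ⌈ F₁ (f A.⊗₁ g) ⌉ ≡ ⌈ f' ⊗₁ g' ⌉
  F-⊗ᵃ {f = f} {g} Ff Fg = trans (F-⊗₁ f g) (⌈⌉-⊗ Ff Fg)

  F-lunit⁻¹ : ∀ X → ⌈ F₁ (A.lunit⁻¹ X) ⌉ ≡ ⌈ lunit⁻¹ (F₀ X) ⌉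
  F-lunit⁻¹ X = ⌈⌉-inverse-unique
    (trans (sym (F-⨾ (A.lunit⁻¹ X) (A.lunit X))) (trans (cong F₁ (A.lunit-iso₂ X)) F-id))
    (lunit-iso₁ (F₀ X))
    (F-lunit X)

  F-lunit-I : ⌈ F₁ (A.lunit A.I) ⌉ ≡ ⌈ lunit I ⌉
  F-lunit-I = trans (F-lunit A.I) (cong (λ Z → ⌈ lunit Z ⌉) F-I)

  ⌈b⌉ : ∀ {X} (U : A.Hom X A.I) → ⌈ castCod F-I (F₁ U) ⌉ ≡ ⌈ F₁ U ⌉
  ⌈b⌉ U = ⌈cast⌉ refl F-I (F₁ U)

  F-preserves-maps : ∀ {X Y} (f : A.Hom X Y) → An.IsMap f → IsMap (F₁ f)
  F-preserves-maps {X} {Y} f (f-d , f-e) = ⌈⌉-injective d-preserved , ⌈⌉-injective e-preserved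
    where
      open ≡-Reasoning
      d-preserved : ⌈ F₁ f ⨾ d (F₀ Y) ⌉ ≡ ⌈ d (F₀ X) ⨾ (F₁ f ⊗₁ F₁ f) ⌉
      d-preserved = begin
        ⌈ F₁ f ⨾ d (F₀ Y) ⌉              ≡⟨ sym (F-⨾ᵃ refl (F-d Y)) ⟩
        ⌈ F₁ (f A.⨾ A.d Y) ⌉              ≡⟨ cong (λ h → ⌈ F₁ h ⌉) f-d ⟩
        ⌈ F₁ (A.d X A.⨾ (f A.⊗₁ f)) ⌉     ≡⟨ F-⨾ᵃ (F-d X) (F-⊗₁ f f) ⟩
        ⌈ d (F₀ X) ⨾ (F₁ f ⊗₁ F₁ f) ⌉    ∎
      e-preserved : ⌈ F₁ f ⨾ e (F₀ Y) ⌉ ≡ ⌈ e (F₀ X) ⌉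
      e-preserved = begin
        ⌈ F₁ f ⨾ e (F₀ Y) ⌉   ≡⟨ sym (F-⨾ᵃ refl (F-e Y)) ⟩
        ⌈ F₁ (f A.⨾ A.e Y) ⌉   ≡⟨ cong (λ h → ⌈ F₁ h ⌉) f-e ⟩
        ⌈ F₁ (A.e X) ⌉         ≡⟨ F-e X ⟩
        ⌈ e (F₀ X) ⌉          ∎

  R₁-isEEDMorphism : IsEEDMorphism A B (R₁ F)
  R₁-isEEDMorphism = record
    { map-preserved = F-preserves-maps
    ; fun-id = F-id
    ; fun-⨾ = λ f g _ _ → F-⨾ f g
    ; fun-× = F-⊗₀
    ; fun-⊤ = F-I
    ; fun-π₁ = λ X Y → ⌈⌉⇒cast≡ (F-⨾ᵃ (F-⊗ᵃ F-idᵃ (F-e Y)) (F-runit X)) (F-⊗₀ X Y) refl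
    ; fun-π₂ = λ X Y → ⌈⌉⇒cast≡ (F-⨾ᵃ (F-⊗ᵃ (F-e X) F-idᵃ) (F-lunit Y)) (F-⊗₀ X Y) refl
    ; comp-natural = λ f _ U → ⌈⌉-injective
        (trans (⌈b⌉ (f A.⨾ U)) (F-⨾ᵃ refl (sym (⌈b⌉ U))))
    ; comp-⊤ = λ X → ⌈⌉-injective (trans (⌈b⌉ (A.e X)) (F-e X))
    ; comp-∧ = λ X U V → ⌈⌉-injective
        (trans (⌈b⌉ (U An.∧ₚ V))
               (F-⨾ᵃ (F-d X) (F-⨾ᵃ (F-⊗ᵃ (sym (⌈b⌉ U)) (sym (⌈b⌉ V))) F-lunit-I)))
    ; comp-δ = λ X → ⌈⌉⇒cast≡
        (trans (⌈b⌉ (An.δ X)) (F-⨾ᵃ (F-d* X) (F-e X))) (F-⊗₀ X X) refl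
    ; comp-∃ = λ X Y V → ⌈⌉-injective
        (trans (⌈b⌉ (An.∃π₂ X Y V))
               (F-⨾ᵃ (F-lunit⁻¹ Y)
                     (F-⨾ᵃ (F-⊗ᵃ (F-e* X) F-idᵃ)
                           (sym (trans (⌈cast⌉ (F-⊗₀ X Y) refl _) (⌈b⌉ V))))))
    }

R₁-∘ : ∀ {o ℓ r} {A B C : CartesianBicategory o ℓ r} (F : CBCMorphism A B) (G : CBCMorphism B C) →
       R₁ (G ∘CBC F) ≈EED (R₁ G ∘EED R₁ F)
R₁-∘ {B = B} {C} F G = (λ X → refl) , (λ f _ → refl) , λ X U →
  ⌈⌉-injective (trans (⌈cast⌉ _ _ _)
                      (sym (trans (⌈cast⌉ _ _ _) (cong (arrMap G) (ArrowEquality.⌈cast⌉ B _ _ _)))))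
  where open ArrowEquality C

R₁-id : ∀ {o ℓ r} (A : CartesianBicategory o ℓ r) → R₁ (idCBC A) ≈EED idEED A
R₁-id A = (λ X → refl) , (λ f _ → refl) , (λ X U → refl)

proposition5p3 : ∀ {o ℓ r} →
    (∀ (A B : CartesianBicategory o ℓ r) (F : CBCMorphism A B) → IsEEDMorphism A B (R₁ F))
    × (∀ (A : CartesianBicategory o ℓ r) → R₁ (idCBC A) ≈EED idEED A)
    × (∀ (A B C : CartesianBicategory o ℓ r) (F : CBCMorphism A B) (G : CBCMorphism B C) →
         R₁ (G ∘CBC F) ≈EED (R₁ G ∘EED R₁ F))
proposition5p3 =
    (λ A B F → MorphismPreservation.R₁-isEEDMorphism F)
  , R₁-id
  , (λ A B C F G → R₁-∘ F G)
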